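{- Every first-order formula is equivalent to a bounded DATALOG$^r$ formula: for every first-order formula $\phi(\bar x)$ over a vocabulary $\sigma$ with free variables $\bar x=x_1,\dots,x_r$ there is a DATALOG$^r$ program $\Pi$ with $(\tau,\Pi)_{ext}=\sigma$ and an $r$-ary intentional symbol $P$ such that $(\Pi,P)\bar t$ is bounded and, for every finite $\sigma$-structure $\mathcal A$ and all $\bar a\in A^r$, $\mathcal A\models\phi[\bar a]$ iff $\mathcal A\models(\Pi,P)[\bar a]$.
   Context: All structures are finite. A DATALOG program $\Pi$ over a vocabulary $\tau$ is a finite set of rules $\beta\leftarrow\alpha_1,\dots,\alpha_l$ ($l\ge0$), where each $\alpha_i$ is an atomic formula, a negated atomic formula, or a zero-ary relation symbol, and the head $\beta$ is an atomic formula $R\bar x$ or a zero-ary relation symbol. Relation symbols occurring in some head are intentional; all other symbols of $\tau$ (including constants) are extensional, forming $(\tau,\Pi)_{ext}$; intentional symbols occur only positively in the rules. A DATALOG$^r$ program additionally allows in rule bodies formulas $\forall\bar yR\bar y\bar z$ with $R$ intentional. Semantics: for a finite $(\tau,\Pi)_{ext}$-structure $\mathcal A$, intentional relations start as $R_{(0)}=\emptyset$, and $R_{(i+1)}$ is the set of tuples $\bar a$ such that for some rule with head $R\bar x$ and some assignment mapping $\bar x$ to $\bar a$, all body formulas hold in $\mathcal A$ expanded by the stage-$i$ relations; the stages increase to a fixed point $R_{(\infty)}=\bigcup_nR_{(n)}$. $\mathcal A\models(\Pi,P)[\bar a]$ iff $\bar a\in P_{(\infty)}$ (for zero-ary $P$: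 iff $P_{(\infty)}$ is TRUE). $(\Pi,P)\bar t$ is bounded if there is a fixed $k\ge0$ with $P_{(k)}=P_{(\infty)}$ on all finite structures. -}

module Defs where

open import Data.Nat using (ℕ; suc; _+_)
open import Data.Fin using (Fin)
open import Data.Vec using (Vec; map; _++_; lookup)
open import Data.List using (List)
open import Data.List.Relation.Unary.Any using (Any)
open import Data.List.Relation.Unary.All using (All)
open import Data.Bool using (Bool; true)
open import Data.Product using (Σ; _×_; _,_; ∃)
open import Data.Sum using (_⊎_)
open import Data.Empty using (⊥)
open import Relation.Nullary using (¬_)
open import Relation.Binary.PropositionalEquality using (_≡_; subst)
open import Function.Bundles using (_⇔_)

record Sig : Set where
  field
    nRel  : ℕ
    arity : Fin nRel → ℕ
    nConst : ℕ
open Sig public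

-- Finite σ-structures with universe Fin (suc n) (nonempty, finite).
-- Relations are given by their (decidable) characteristic functions.

record Structure (σ : Sig) (n : ℕ) : Set where
  field
    rel   : (R : Fin (nRel σ)) → Vec (Fin (suc n)) (arity σ R) → Bool
    const : Fin (nConst σ) → Fin (suc n)
open Structure public

data Term (σ : Sig) (k : ℕ) : Set where
  var : Fin k → Term σ k
  con : Fin (nConst σ) → Term σ k

evalTerm : ∀ {σ n k} → Structure σ n → (Fin k → Fin (suc n)) → Term σ k → Fin (suc n)
evalTerm 𝒜 s (var x) = s x
evalTerm 𝒜 s (con c) = const 𝒜 c

-- First-order formulas over σ with free variables among x₀ … x_{k-1}
-- (de Bruijn: a quantifier binds variable 0 of the extended context).

data Formula (σ : Sig) : ℕ → Set where
  atom : ∀ {k} (R : Fin (nRel σ)) → Vec (Term σ k) (arity σ R) → Formula σ k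
  equ  : ∀ {k} → Term σ k → Term σ k → Formula σ k
  neg  : ∀ {k} → Formula σ k → Formula σ k
  and  : ∀ {k} → Formula σ k → Formula σ k → Formula σ k
  or   : ∀ {k} → Formula σ k → Formula σ k → Formula σ k
  all  : ∀ {k} → Formula σ (suc k) → Formula σ k
  ex   : ∀ {k} → Formula σ (suc k) → Formula σ k

extend : ∀ {k} {A : Set} → A → (Fin k → A) → Fin (suc k) → A
extend a s Fin.zero = a
extend a s (Fin.suc i) = s i

Sat : ∀ {σ n k} → Structure σ n → Formula σ k → (Fin k → Fin (suc n)) → Set
Sat 𝒜 (atom R ts) s = rel 𝒜 R (map (evalTerm 𝒜 s) ts) ≡ true
Sat 𝒜 (equ t u)   s = evalTerm 𝒜 s t ≡ evalTerm 𝒜 s u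
Sat 𝒜 (neg φ)     s = ¬ Sat 𝒜 φ s
Sat 𝒜 (and φ ψ)   s = Sat 𝒜 φ s × Sat 𝒜 ψ s
Sat 𝒜 (or φ ψ)    s = Sat 𝒜 φ s ⊎ Sat 𝒜 ψ s
Sat 𝒜 (all φ)     s = ∀ a → Sat 𝒜 φ (extend a s)
Sat 𝒜 (ex φ)      s = Σ _ λ a → Sat 𝒜 φ (extend a s)

_⊨_[_] : ∀ {σ n r} → Structure σ n → Formula σ r → Vec (Fin (suc n)) r → Set
𝒜 ⊨ φ [ as ] = Sat 𝒜 φ (lookup as)

-- DATALOG^r programs.  The vocabulary τ consists of σ (extensional)
-- together with nI intentional symbols with arities iar.
-- A rule has v variables.  Body formulas:

module _ (σ : Sig) (nI : ℕ) (iar : Fin nI → ℕ) where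

  data Literal (v : ℕ) : Set where
    eAtom  : (R : Fin (nRel σ)) → Vec (Term σ v) (arity σ R) → Literal v
    eNAtom : (R : Fin (nRel σ)) → Vec (Term σ v) (arity σ R) → Literal v
    eEq    : Term σ v → Term σ v → Literal v
    eNEq   : Term σ v → Term σ v → Literal v
    iAtom  : (R : Fin nI) → Vec (Term σ v) (iar R) → Literal v
    -- ∀ȳ R ȳ z̄ : ȳ are m fresh (distinct) variables filling the first
    -- m argument places of R, z̄ the remaining k argument terms
    iAll   : (R : Fin nI) (m : ℕ) {k : ℕ} → Vec (Term σ v) k →
             m + k ≡ iar R → Literal v

  record Rule : Set where
    field
      nVar  : ℕ
      head  : Fin nI
      hvars : Vec (Fin nVar) (iar head)
      body  : List (Literal nVar)

record Program (σ : Sig) : Set where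
  field
    nI    : ℕ
    iar   : Fin nI → ℕ
    rules : List (Rule σ nI iar)
open Program public

-- Every declared intentional symbol occurs in the head of some rule,
-- so the intentional symbols are exactly the heads and (τ,Π)_ext = σ.
HeadsExact : ∀ {σ} → Program σ → Set
HeadsExact Π = (i : Fin (nI Π)) → Any (λ ρ → Rule.head ρ ≡ i) (rules Π)

module Semantics {σ : Sig} (Π : Program σ) {n : ℕ} (𝒜 : Structure σ n) where
  A : Set
  A = Fin (suc n)

  Interp : Set₁
  Interp = (i : Fin (nI Π)) → Vec A (iar Π i) → Set

  Tup : Set
  Tup = Σ (Fin (nI Π)) λ i → Vec A (iar Π i)

  evalLit : ∀ {v} → Interp → (Fin v → A) → Literal σ (nI Π) (iar Π) v → Set
  evalLit I s (eAtom R ts)  = rel 𝒜 R (map (evalTerm 𝒜 s) ts) ≡ true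
  evalLit I s (eNAtom R ts) = ¬ (rel 𝒜 R (map (evalTerm 𝒜 s) ts) ≡ true)
  evalLit I s (eEq t u)     = evalTerm 𝒜 s t ≡ evalTerm 𝒜 s u
  evalLit I s (eNEq t u)    = ¬ (evalTerm 𝒜 s t ≡ evalTerm 𝒜 s u)
  evalLit I s (iAtom R ts)  = I R (map (evalTerm 𝒜 s) ts)
  evalLit I s (iAll R m zs e) =
    (ys : Vec A m) → I R (subst (Vec A) e (ys ++ map (evalTerm 𝒜 s) zs))

  Fires : Interp → Rule σ (nI Π) (iar Π) → Tup → Set
  Fires I ρ t =
    Σ (Fin (Rule.nVar ρ) → A) λ s →
      ((Rule.head ρ , map s (Rule.hvars ρ)) ≡ t) ×
      All (evalLit I s) (Rule.body ρ)

  Stage : ℕ → Interp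
  Stage ℕ.zero i as = ⊥
  Stage (suc k) i as = Any (λ ρ → Fires (Stage k) ρ (i , as)) (rules Π)

  Fix : Interp
  Fix i as = ∃ λ k → Stage k i as

_⊨⟨_,_⟩[_] : ∀ {σ n} → Structure σ n → (Π : Program σ) → (P : Fin (nI Π)) →
             Vec (Fin (suc n)) (iar Π P) → Set
𝒜 ⊨⟨ Π , P ⟩[ as ] = Semantics.Fix Π 𝒜 P as

Bounded : ∀ {σ} → (Π : Program σ) → Fin (nI Π) → Set
Bounded {σ} Π P = ∃ λ (k : ℕ) → ∀ (n : ℕ) (𝒜 : Structure σ n)
  (as : Vec (Fin (suc n)) (iar Π P)) →
  Semantics.Stage Π 𝒜 k P as ⇔ Semantics.Fix Π 𝒜 P as

-- Put φ in negation normal form (harmless constructively, since satisfaction in a finite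
-- structure is decidable) and give every node of the resulting tree an intentional symbol of
-- one common arity N, whose argument tuple lists the values of the node's free variables, de
-- Bruijn index i at position i, followed by unused positions. A literal node gets a rule whose
-- body is that literal, a conjunction one rule calling both children, a disjunction one rule
-- per child, an existential quantifier a rule with one more body variable, and a universal
-- quantifier a rule with body ∀y R y z̄. By induction on the tree, from stage (height ψ) on
-- the symbol of a node ψ holds exactly on the tuples satisfying ψ. A final rule projects the
-- root symbol onto the r free variables of φ; as stages increase, the fixed point of that
-- answer symbol is reached at stage 1 + height φ.

module Submission where

open import Defs
open import Data.Bool using (true)
import Data.Bool.Properties as Bool
open import Data.Fin using (Fin; zero; suc; inject≤; splitAt; _↑ˡ_; _↑ʳ_)
import Data.Fin.Properties as Fin
open import Data.List as List using (List; []; _∷_)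
open import Data.List.NonEmpty as List⁺ using (List⁺; _∷_; toList)
open import Data.List.Relation.Unary.All as All using (All; []; _∷_)
import Data.List.Relation.Unary.All.Properties as All
open import Data.List.Relation.Unary.Any as Any using (Any; here; there)
import Data.List.Relation.Unary.Any.Properties as Any
open import Data.Nat using (ℕ; zero; suc; _+_; _⊔_; _≤_; s≤s; _≤′_; ≤′-refl; ≤′-step)
open import Data.Nat.Properties
  using (≤-refl; ≤-trans; ≤-reflexive; ≤⇒≤′; m≤m⊔n; m≤n⊔m; +-monoʳ-≤; +-suc; m+n≤o⇒m≤o;
         m≤n⇒m≤1+n; n≤1+n)
open import Data.Product using (Σ; _×_; _,_; proj₁; proj₂)
open import Data.Product.Function.NonDependent.Propositional using (_×-⇔_)
open import Data.Sum using (_⊎_; inj₁; inj₂; [_,_]′)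
open import Data.Sum.Function.Propositional using (_⊎-⇔_)
open import Data.Vec using (Vec; []; _∷_; _++_; map; lookup; tabulate; allFin; padRight)
open import Data.Vec.Properties
  using (map-cong; map-∘; lookup-map; lookup-allFin; lookup∘tabulate; tabulate∘lookup;
         tabulate-∘; tabulate-cong; map-lookup-allFin; lookup-truncate; truncate-padRight)
open import Function using (_∘_; id)
open import Function.Bundles using (_⇔_; mk⇔; Equivalence)
open import Function.Construct.Composition using (_⇔-∘_)
open import Function.Construct.Symmetry using (⇔-sym)
open import Function.Related.Propositional using (module EquationalReasoning; equivalence)
open import Function.Related.TypeIsomorphisms using (¬-cong-⇔)
open import Relation.Binary.PropositionalEquality
  using (_≡_; refl; sym; trans; cong; subst; _≗_)
open import Relation.Nullary using (¬_; Dec; yes; no; ¬?)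
open import Relation.Nullary.Decidable using (_×-dec_; _⊎-dec_; decidable-stable)

open EquationalReasoning {k = equivalence}

≡⇒⇔ : ∀ {X : Set} (P : X → Set) {x y : X} → x ≡ y → P x ⇔ P y
≡⇒⇔ P e = mk⇔ (subst P e) (subst P (sym e))

≡-cong-⇔ : ∀ {X : Set} {x x′ y y′ : X} → x ≡ x′ → y ≡ y′ → (x ≡ y) ⇔ (x′ ≡ y′)
≡-cong-⇔ refl refl = mk⇔ id id

∀-cong-⇔ : ∀ {X : Set} {P Q : X → Set} → (∀ x → P x ⇔ Q x) → (∀ x → P x) ⇔ (∀ x → Q x)
∀-cong-⇔ P⇔Q =
  mk⇔ (λ f x → Equivalence.to (P⇔Q x) (f x)) (λ g x → Equivalence.from (P⇔Q x) (g x))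

∃-cong-⇔ : ∀ {X : Set} {P Q : X → Set} → (∀ x → P x ⇔ Q x) → Σ X P ⇔ Σ X Q
∃-cong-⇔ P⇔Q =
  mk⇔ (λ (x , p) → x , Equivalence.to (P⇔Q x) p) (λ (x , q) → x , Equivalence.from (P⇔Q x) q)

¬¬-⇔ : ∀ {P : Set} → Dec P → P ⇔ (¬ ¬ P)
¬¬-⇔ P? = mk⇔ (λ p ¬p → ¬p p) (decidable-stable P?)

¬⊎¬-⇔ : ∀ {P Q : Set} → Dec P → (¬ P ⊎ ¬ Q) ⇔ (¬ (P × Q))
¬⊎¬-⇔ P? = mk⇔ (λ { (inj₁ ¬p) (p , _) → ¬p p ; (inj₂ ¬q) (_ , q) → ¬q q }) (from P?)
  where
  from : ∀ {P Q : Set} → Dec P → ¬ (P × Q) → ¬ P ⊎ ¬ Q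
  from (yes p) ¬pq = inj₂ (λ q → ¬pq (p , q))
  from (no ¬p) _   = inj₁ ¬p

¬×¬-⇔ : ∀ {P Q : Set} → (¬ P × ¬ Q) ⇔ (¬ (P ⊎ Q))
¬×¬-⇔ = mk⇔ (λ (¬p , ¬q) → [ ¬p , ¬q ]′) (λ ¬pq → ¬pq ∘ inj₁ , ¬pq ∘ inj₂)

∃¬-⇔ : ∀ {m} {P : Fin m → Set} → (∀ i → Dec (P i)) → Σ (Fin m) (¬_ ∘ P) ⇔ (¬ (∀ i → P i))
∃¬-⇔ {m} {P} P? = mk⇔ (λ (i , ¬p) ∀p → ¬p (∀p i)) (Fin.¬∀⟶∃¬ m P P?)

∀¬-⇔ : ∀ {X : Set} {P : X → Set} → (∀ x → ¬ P x) ⇔ (¬ Σ X P)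
∀¬-⇔ = mk⇔ (λ ∀¬p (x , p) → ∀¬p x p) (λ ¬∃p x p → ¬∃p (x , p))

all-singleton-⇔ : ∀ {X : Set} {P : X → Set} {x} → All P (x ∷ []) ⇔ P x
all-singleton-⇔ = mk⇔ All.head (_∷ [])

all-pair-⇔ : ∀ {X : Set} {P : X → Set} {x y} → All P (x ∷ y ∷ []) ⇔ (P x × P y)
all-pair-⇔ = mk⇔ (λ { (px ∷ py ∷ []) → px , py }) (λ (px , py) → px ∷ py ∷ [])

m+[n⊔o]≤p⇒m+n≤p : ∀ m n o {p} → m + (n ⊔ o) ≤ p → m + n ≤ p
m+[n⊔o]≤p⇒m+n≤p m n o = ≤-trans (+-monoʳ-≤ m (m≤m⊔n n o))

m+[n⊔o]≤p⇒m+o≤p : ∀ m n o {p} → m + (n ⊔ o) ≤ p → m + o ≤ p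
m+[n⊔o]≤p⇒m+o≤p m n o = ≤-trans (+-monoʳ-≤ m (m≤n⊔m n o))

m+[1+n]≤o⇒1+m+n≤o : ∀ m n {o} → m + suc n ≤ o → suc m + n ≤ o
m+[1+n]≤o⇒1+m+n≤o m n = ≤-trans (≤-reflexive (sym (+-suc m n)))

m+n≤o⇒m≤1+o : ∀ m {n o} → m + n ≤ o → m ≤ suc o
m+n≤o⇒m≤1+o m = m≤n⇒m≤1+n ∘ m+n≤o⇒m≤o m

-- First-order satisfaction and negation normal form

module _ {σ : Sig} {n : ℕ} (𝒜 : Structure σ n) where

  evalTerm-cong : ∀ {k} {s s′ : Fin k → Fin (suc n)} → s ≗ s′ → evalTerm 𝒜 s ≗ evalTerm 𝒜 s′
  evalTerm-cong s≗s′ (var x) = s≗s′ x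
  evalTerm-cong s≗s′ (con c) = refl

  extend-cong : ∀ {k} {s s′ : Fin k → Fin (suc n)} a → s ≗ s′ → extend a s ≗ extend a s′
  extend-cong a s≗s′ zero    = refl
  extend-cong a s≗s′ (suc j) = s≗s′ j

  sat? : ∀ {k} (ψ : Formula σ k) s → Dec (Sat 𝒜 ψ s)
  sat? (atom R ts) s = rel 𝒜 R _ Bool.≟ true
  sat? (equ t u)   s = evalTerm 𝒜 s t Fin.≟ evalTerm 𝒜 s u
  sat? (neg ψ)     s = ¬? (sat? ψ s)
  sat? (and ψ₁ ψ₂) s = sat? ψ₁ s ×-dec sat? ψ₂ s
  sat? (or ψ₁ ψ₂)  s = sat? ψ₁ s ⊎-dec sat? ψ₂ s
  sat? (all θ)     s = Fin.all? (λ a → sat? θ (extend a s))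
  sat? (ex θ)      s = Fin.any? (λ a → sat? θ (extend a s))

data Lit (σ : Sig) (k : ℕ) : Set where
  atom⁺ atom⁻ : (R : Fin (nRel σ)) → Vec (Term σ k) (arity σ R) → Lit σ k
  equ⁺ equ⁻   : Term σ k → Term σ k → Lit σ k

data NNF (σ : Sig) : ℕ → Set where
  lit    : ∀ {k} → Lit σ k → NNF σ k
  and or : ∀ {k} → NNF σ k → NNF σ k → NNF σ k
  all ex : ∀ {k} → NNF σ (suc k) → NNF σ k

nnf⁺ nnf⁻ : ∀ {σ k} → Formula σ k → NNF σ k
nnf⁺ (atom R ts) = lit (atom⁺ R ts)
nnf⁺ (equ t u)   = lit (equ⁺ t u)
nnf⁺ (neg ψ)     = nnf⁻ ψ
nnf⁺ (and ψ₁ ψ₂) = and (nnf⁺ ψ₁) (nnf⁺ ψ₂)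
nnf⁺ (or ψ₁ ψ₂)  = or (nnf⁺ ψ₁) (nnf⁺ ψ₂)
nnf⁺ (all θ)     = all (nnf⁺ θ)
nnf⁺ (ex θ)      = ex (nnf⁺ θ)
nnf⁻ (atom R ts) = lit (atom⁻ R ts)
nnf⁻ (equ t u)   = lit (equ⁻ t u)
nnf⁻ (neg ψ)     = nnf⁺ ψ
nnf⁻ (and ψ₁ ψ₂) = or (nnf⁻ ψ₁) (nnf⁻ ψ₂)
nnf⁻ (or ψ₁ ψ₂)  = and (nnf⁻ ψ₁) (nnf⁻ ψ₂)
nnf⁻ (all θ)     = ex (nnf⁻ θ)
nnf⁻ (ex θ)      = all (nnf⁻ θ)

-- nodes ψ is a successor by definition, so that zero : Fin (nodes ψ) names the root.
descendants nodes depth height : ∀ {σ k} → NNF σ k → ℕ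
descendants (lit _)     = 0
descendants (and ψ₁ ψ₂) = nodes ψ₁ + nodes ψ₂
descendants (or ψ₁ ψ₂)  = nodes ψ₁ + nodes ψ₂
descendants (all θ)     = nodes θ
descendants (ex θ)      = nodes θ
nodes ψ = suc (descendants ψ)
depth (lit _)     = 0
depth (and ψ₁ ψ₂) = depth ψ₁ ⊔ depth ψ₂
depth (or ψ₁ ψ₂)  = depth ψ₁ ⊔ depth ψ₂
depth (all θ)     = suc (depth θ)
depth (ex θ)      = suc (depth θ)
height (lit _)     = 1
height (and ψ₁ ψ₂) = suc (height ψ₁ ⊔ height ψ₂)
height (or ψ₁ ψ₂)  = suc (height ψ₁ ⊔ height ψ₂)
height (all θ)     = suc (height θ)
height (ex θ)      = suc (height θ)

module _ {σ : Sig} {n : ℕ} (𝒜 : Structure σ n) where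

  SatLit : ∀ {k} → Lit σ k → (Fin k → Fin (suc n)) → Set
  SatLit (atom⁺ R ts) s = Sat 𝒜 (atom R ts) s
  SatLit (atom⁻ R ts) s = ¬ Sat 𝒜 (atom R ts) s
  SatLit (equ⁺ t u)   s = Sat 𝒜 (equ t u) s
  SatLit (equ⁻ t u)   s = ¬ Sat 𝒜 (equ t u) s

  SatNNF : ∀ {k} → NNF σ k → (Fin k → Fin (suc n)) → Set
  SatNNF (lit l)     s = SatLit l s
  SatNNF (and ψ₁ ψ₂) s = SatNNF ψ₁ s × SatNNF ψ₂ s
  SatNNF (or ψ₁ ψ₂)  s = SatNNF ψ₁ s ⊎ SatNNF ψ₂ s
  SatNNF (all θ)     s = ∀ a → SatNNF θ (extend a s)
  SatNNF (ex θ)      s = Σ _ λ a → SatNNF θ (extend a s)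

  satLit-cong : ∀ {k} {s s′ : Fin k → Fin (suc n)} → s ≗ s′ → ∀ l → SatLit l s → SatLit l s′
  satLit-cong s≗s′ (atom⁺ R ts) =
    subst (λ xs → rel 𝒜 R xs ≡ true) (map-cong (evalTerm-cong 𝒜 s≗s′) ts)
  satLit-cong s≗s′ (atom⁻ R ts) ¬p = ¬p ∘ satLit-cong (sym ∘ s≗s′) (atom⁺ R ts)
  satLit-cong s≗s′ (equ⁺ t u)   p  =
    trans (sym (evalTerm-cong 𝒜 s≗s′ t)) (trans p (evalTerm-cong 𝒜 s≗s′ u))
  satLit-cong s≗s′ (equ⁻ t u)   ¬p = ¬p ∘ satLit-cong (sym ∘ s≗s′) (equ⁺ t u)

  satNNF-cong : ∀ {k} {s s′ : Fin k → Fin (suc n)} → s ≗ s′ → ∀ ψ → SatNNF ψ s → SatNNF ψ s′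
  satNNF-cong s≗s′ (lit l)     p         = satLit-cong s≗s′ l p
  satNNF-cong s≗s′ (and ψ₁ ψ₂) (p₁ , p₂) = satNNF-cong s≗s′ ψ₁ p₁ , satNNF-cong s≗s′ ψ₂ p₂
  satNNF-cong s≗s′ (or ψ₁ ψ₂)  (inj₁ p₁) = inj₁ (satNNF-cong s≗s′ ψ₁ p₁)
  satNNF-cong s≗s′ (or ψ₁ ψ₂)  (inj₂ p₂) = inj₂ (satNNF-cong s≗s′ ψ₂ p₂)
  satNNF-cong s≗s′ (all θ)     p a       = satNNF-cong (extend-cong 𝒜 a s≗s′) θ (p a)
  satNNF-cong s≗s′ (ex θ)      (a , p)   = a , satNNF-cong (extend-cong 𝒜 a s≗s′) θ p

  satNNF-≗-⇔ : ∀ {k} {s s′ : Fin k → Fin (suc n)} → s ≗ s′ → ∀ ψ → SatNNF ψ s ⇔ SatNNF ψ s′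
  satNNF-≗-⇔ s≗s′ ψ = mk⇔ (satNNF-cong s≗s′ ψ) (satNNF-cong (sym ∘ s≗s′) ψ)

  nnf⁺-correct : ∀ {k} (ψ : Formula σ k) s → SatNNF (nnf⁺ ψ) s ⇔ Sat 𝒜 ψ s
  nnf⁻-correct : ∀ {k} (ψ : Formula σ k) s → SatNNF (nnf⁻ ψ) s ⇔ (¬ Sat 𝒜 ψ s)
  nnf⁺-correct (atom R ts) s = mk⇔ id id
  nnf⁺-correct (equ t u)   s = mk⇔ id id
  nnf⁺-correct (neg ψ)     s = nnf⁻-correct ψ s
  nnf⁺-correct (and ψ₁ ψ₂) s = nnf⁺-correct ψ₁ s ×-⇔ nnf⁺-correct ψ₂ s
  nnf⁺-correct (or ψ₁ ψ₂)  s = nnf⁺-correct ψ₁ s ⊎-⇔ nnf⁺-correct ψ₂ s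
  nnf⁺-correct (all θ)     s = ∀-cong-⇔ λ a → nnf⁺-correct θ (extend a s)
  nnf⁺-correct (ex θ)      s = ∃-cong-⇔ λ a → nnf⁺-correct θ (extend a s)
  nnf⁻-correct (atom R ts) s = mk⇔ id id
  nnf⁻-correct (equ t u)   s = mk⇔ id id
  nnf⁻-correct (neg ψ)     s = ¬¬-⇔ (sat? 𝒜 ψ s) ⇔-∘ nnf⁺-correct ψ s
  nnf⁻-correct (and ψ₁ ψ₂) s =
    ¬⊎¬-⇔ (sat? 𝒜 ψ₁ s) ⇔-∘ (nnf⁻-correct ψ₁ s ⊎-⇔ nnf⁻-correct ψ₂ s)
  nnf⁻-correct (or ψ₁ ψ₂)  s = ¬×¬-⇔ ⇔-∘ (nnf⁻-correct ψ₁ s ×-⇔ nnf⁻-correct ψ₂ s)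
  nnf⁻-correct (all θ)     s =
    ∃¬-⇔ (λ a → sat? 𝒜 θ (extend a s)) ⇔-∘ ∃-cong-⇔ λ a → nnf⁻-correct θ (extend a s)
  nnf⁻-correct (ex θ)      s = ∀¬-⇔ ⇔-∘ ∀-cong-⇔ λ a → nnf⁻-correct θ (extend a s)

-- Stages of DATALOG^r programs

module StageProperties {σ : Sig} (Π : Program σ) {n : ℕ} (𝒜 : Structure σ n) where
  open Semantics Π 𝒜

  _⊆ᴵ_ : Interp → Interp → Set
  I ⊆ᴵ J = ∀ {i v} → I i v → J i v

  evalLit-mono : ∀ {I J v} (s : Fin v → A) → I ⊆ᴵ J → ∀ l → evalLit I s l → evalLit J s l
  evalLit-mono s I⊆J (eAtom R ts)    p = p
  evalLit-mono s I⊆J (eNAtom R ts)   p = p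
  evalLit-mono s I⊆J (eEq t u)       p = p
  evalLit-mono s I⊆J (eNEq t u)      p = p
  evalLit-mono s I⊆J (iAtom R ts)    p = I⊆J p
  evalLit-mono s I⊆J (iAll R m zs e) p = I⊆J ∘ p

  evalLit-cong : ∀ I {v} {s s′ : Fin v → A} → s ≗ s′ → ∀ l → evalLit I s l → evalLit I s′ l
  evalLit-cong I s≗s′ (eAtom R ts) =
    subst (λ xs → rel 𝒜 R xs ≡ true) (map-cong (evalTerm-cong 𝒜 s≗s′) ts)
  evalLit-cong I s≗s′ (eNAtom R ts) ¬p = ¬p ∘ evalLit-cong I (sym ∘ s≗s′) (eAtom R ts)
  evalLit-cong I s≗s′ (eEq t u) p =
    trans (sym (evalTerm-cong 𝒜 s≗s′ t)) (trans p (evalTerm-cong 𝒜 s≗s′ u))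
  evalLit-cong I s≗s′ (eNEq t u) ¬p = ¬p ∘ evalLit-cong I (sym ∘ s≗s′) (eEq t u)
  evalLit-cong I s≗s′ (iAtom R ts) = subst (I R) (map-cong (evalTerm-cong 𝒜 s≗s′) ts)
  evalLit-cong I s≗s′ (iAll R m zs e) p ys =
    subst (λ ws → I R (subst (Vec A) e (ys ++ ws))) (map-cong (evalTerm-cong 𝒜 s≗s′) zs) (p ys)

  fires⇒head : ∀ {I ρ i v} → Fires I ρ (i , v) → Rule.head ρ ≡ i
  fires⇒head (_ , eq , _) = cong proj₁ eq

  stage-step : ∀ k → Stage k ⊆ᴵ Stage (suc k)
  stage-step zero    ()
  stage-step (suc k) =
    Any.map λ (s , eq , ps) → s , eq , All.map (λ {l} → evalLit-mono s (stage-step k) l) ps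

  stage-mono : ∀ {k k′} → k ≤′ k′ → Stage k ⊆ᴵ Stage k′
  stage-mono ≤′-refl             = id
  stage-mono (≤′-step {k′} k≤k′) = stage-step k′ ∘ stage-mono k≤k′

  Defines : (i : Fin (nI Π)) → (Vec A (iar Π i) → Set) → ℕ → Set
  Defines i Q h = ∀ {k} → h ≤ k → ∀ v → Stage k i v ⇔ Q v

  defines⇒fix⇔ : ∀ {i Q h} → Defines i Q h → ∀ v → Fix i v ⇔ Q v
  defines⇒fix⇔ {h = h} D v = mk⇔
    (λ (k , x) → Equivalence.to (D (m≤n⊔m k h) v) (stage-mono (≤⇒≤′ (m≤m⊔n k h)) x))
    (λ q → h , Equivalence.from (D ≤-refl v) q)

  defines⇒stage⇔fix : ∀ {i Q h} → Defines i Q h → ∀ v → Stage h i v ⇔ Fix i v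
  defines⇒stage⇔fix D v = ⇔-sym (defines⇒fix⇔ D v) ⇔-∘ D ≤-refl v

module Headwise {σ : Sig} {nI : ℕ} {iar : Fin nI → ℕ}
    (rulesFor : (i : Fin nI) → List⁺ (Rule σ nI iar))
    (heads : ∀ i → All (λ ρ → Rule.head ρ ≡ i) (toList (rulesFor i))) where

  program : Program σ
  program = record
    { nI = nI ; iar = iar ; rules = List.concat (List.tabulate (toList ∘ rulesFor)) }

  headsExact : HeadsExact program
  headsExact i = Any.concat⁺ (Any.tabulate⁺ i (here (All.head (heads i))))

  module _ {n : ℕ} (𝒜 : Structure σ n) where
    open Semantics program 𝒜
    open StageProperties program 𝒜

    stage-suc : ∀ k i v →
      Stage (suc k) i v ⇔ Any (λ ρ → Fires (Stage k) ρ (i , v)) (toList (rulesFor i))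
    stage-suc k i v = mk⇔ to (Any.concat⁺ ∘ Any.tabulate⁺ i)
      where
      to : Stage (suc k) i v → Any (λ ρ → Fires (Stage k) ρ (i , v)) (toList (rulesFor i))
      to x with Any.tabulate⁻ (Any.concat⁻ (List.tabulate (toList ∘ rulesFor)) x)
      ... | j , fired = subst (λ j → Any _ (toList (rulesFor j))) j≡i fired
        where
        j≡i : j ≡ i
        j≡i = All.lookupWith (λ head≡j f → trans (sym head≡j) (fires⇒head f)) (heads j) fired

-- The program of a formula in negation normal form

-- Symbol zero is the answer symbol, of arity r; the C node symbols have arity N, room for the
-- r free variables of the formula plus d nested quantifiers (and one spare position).
module Compilation (σ : Sig) (r d C : ℕ) where

  M N : ℕ
  M = r + d
  N = suc M

  r≤N : r ≤ N
  r≤N = m+n≤o⇒m≤1+o r ≤-refl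

  symbolArity : Fin (suc C) → ℕ
  symbolArity zero    = r
  symbolArity (suc _) = N

  Literal′ : ℕ → Set
  Literal′ = Literal σ (suc C) symbolArity

  record Clause : Set where
    constructor clause
    field
      nVar  : ℕ
      hvars : Vec (Fin nVar) N
      body  : List (Literal′ nVar)

  plain : List (Literal′ N) → Clause
  plain = clause N (allFin N)

  withWitness : List (Literal′ (suc N)) → Clause
  withWitness = clause (suc N) (tabulate suc)

  nodeRule : Fin C → Clause → Rule σ (suc C) symbolArity
  nodeRule j (clause m xs b) = record { nVar = m ; head = suc j ; hvars = xs ; body = b }

  call : ∀ {v} → Fin C → Vec (Term σ v) N → Literal′ v
  call c = iAtom (suc c)

  vars : Vec (Term σ N) N
  vars = tabulate var

  -- ∀ȳ fills the first argument place, so a quantifier node hands its child the bound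
  -- value at position 0 followed by all of its own positions but the last.
  initVars : ∀ {v} → (Fin N → Fin v) → Vec (Term σ v) M
  initVars f = tabulate (λ j → var (f (inject≤ j (n≤1+n M))))

  liftTerm : ∀ {k} → .(k ≤ N) → Term σ k → Term σ N
  liftTerm q (var x) = var (inject≤ x q)
  liftTerm q (con c) = con c

  liftLit : ∀ {k} → .(k ≤ N) → Lit σ k → Literal′ N
  liftLit q (atom⁺ R ts) = eAtom R (map (liftTerm q) ts)
  liftLit q (atom⁻ R ts) = eNAtom R (map (liftTerm q) ts)
  liftLit q (equ⁺ t u)   = eEq (liftTerm q t) (liftTerm q u)
  liftLit q (equ⁻ t u)   = eNEq (liftTerm q t) (liftTerm q u)

  leftChild : ∀ {m₁} m₂ → Fin m₁ → Fin (suc (m₁ + m₂))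
  leftChild m₂ i = suc (i ↑ˡ m₂)

  rightChild : ∀ m₁ {m₂} → Fin m₂ → Fin (suc (m₁ + m₂))
  rightChild m₁ i = suc (m₁ ↑ʳ i)

  splitClauses : ∀ {m₁ m₂} → (Fin m₁ → List⁺ Clause) → (Fin m₂ → List⁺ Clause) →
                 Fin (m₁ + m₂) → List⁺ Clause
  splitClauses {m₁} f g j = [ f , g ]′ (splitAt m₁ j)

  -- The nodes of ψ are numbered root first, then those of each subformula, left to right;
  -- emb assigns node symbols to them.
  clausesAt : ∀ {k} (ψ : NNF σ k) → .(k + depth ψ ≤ M) → (Fin (nodes ψ) → Fin C) →
              Fin (nodes ψ) → List⁺ Clause
  clausesAt (lit l) p emb zero = plain (liftLit (m+n≤o⇒m≤1+o _ p) l ∷ []) ∷ []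
  clausesAt (and ψ₁ ψ₂) p emb zero =
    plain (call (emb (leftChild (nodes ψ₂) zero)) vars ∷
           call (emb (rightChild (nodes ψ₁) zero)) vars ∷ []) ∷ []
  clausesAt (or ψ₁ ψ₂) p emb zero =
    plain (call (emb (leftChild (nodes ψ₂) zero)) vars ∷ []) ∷
    plain (call (emb (rightChild (nodes ψ₁) zero)) vars ∷ []) ∷ []
  clausesAt (all θ) p emb zero =
    plain (iAll (suc (emb (suc zero))) 1 (initVars id) refl ∷ []) ∷ []
  clausesAt (ex θ) p emb zero =
    withWitness (call (emb (suc zero)) (var zero ∷ initVars suc) ∷ []) ∷ []
  clausesAt {k} (and ψ₁ ψ₂) p emb (suc j) =
    splitClauses (clausesAt ψ₁ (m+[n⊔o]≤p⇒m+n≤p k _ _ p) (emb ∘ leftChild (nodes ψ₂)))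
                 (clausesAt ψ₂ (m+[n⊔o]≤p⇒m+o≤p k _ _ p) (emb ∘ rightChild (nodes ψ₁))) j
  clausesAt {k} (or ψ₁ ψ₂) p emb (suc j) =
    splitClauses (clausesAt ψ₁ (m+[n⊔o]≤p⇒m+n≤p k _ _ p) (emb ∘ leftChild (nodes ψ₂)))
                 (clausesAt ψ₂ (m+[n⊔o]≤p⇒m+o≤p k _ _ p) (emb ∘ rightChild (nodes ψ₁))) j
  clausesAt {k} (all θ) p emb (suc j) = clausesAt θ (m+[1+n]≤o⇒1+m+n≤o k _ p) (emb ∘ suc) j
  clausesAt {k} (ex θ)  p emb (suc j) = clausesAt θ (m+[1+n]≤o⇒1+m+n≤o k _ p) (emb ∘ suc) j

  Realises : (Fin C → List⁺ Clause) → ∀ {k} (ψ : NNF σ k) → .(k + depth ψ ≤ M) →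
             (Fin (nodes ψ) → Fin C) → Set
  Realises clauses ψ p emb = ∀ j → clauses (emb j) ≡ clausesAt ψ p emb j

  realises-split : ∀ {clauses k} {ψ₁ ψ₂ : NNF σ k} .{p₁ p₂}
    {emb : Fin (suc (nodes ψ₁ + nodes ψ₂)) → Fin C} →
    (∀ j → clauses (emb (suc j)) ≡ splitClauses (clausesAt ψ₁ p₁ (emb ∘ leftChild (nodes ψ₂)))
                                                (clausesAt ψ₂ p₂ (emb ∘ rightChild (nodes ψ₁))) j) →
    Realises clauses ψ₁ p₁ (emb ∘ leftChild (nodes ψ₂)) ×
    Realises clauses ψ₂ p₂ (emb ∘ rightChild (nodes ψ₁))
  realises-split {ψ₁ = ψ₁} {ψ₂} R =
    (λ j → trans (R (j ↑ˡ nodes ψ₂)) (cong [ _ , _ ]′ (Fin.splitAt-↑ˡ (nodes ψ₁) j (nodes ψ₂)))) ,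
    (λ j → trans (R (nodes ψ₁ ↑ʳ j)) (cong [ _ , _ ]′ (Fin.splitAt-↑ʳ (nodes ψ₁) (nodes ψ₂) j)))

  module Realisation (clauses : Fin C → List⁺ Clause) (root : Fin C) where

    topRule : Rule σ (suc C) symbolArity
    topRule = record { nVar  = N
                     ; head  = zero
                     ; hvars = tabulate (λ j → inject≤ j r≤N)
                     ; body  = call root vars ∷ [] }

    rulesFor : (i : Fin (suc C)) → List⁺ (Rule σ (suc C) symbolArity)
    rulesFor zero    = topRule ∷ []
    rulesFor (suc j) = List⁺.map (nodeRule j) (clauses j)

    heads : ∀ i → All (λ ρ → Rule.head ρ ≡ i) (toList (rulesFor i))
    heads zero    = refl ∷ []
    heads (suc j) = All.map⁺ (All.universal (λ _ → refl) (toList (clauses j)))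

    open Headwise rulesFor heads public

    module _ {n : ℕ} (𝒜 : Structure σ n) where
      open Semantics program 𝒜
      open StageProperties program 𝒜

      restrict : ∀ {k} → .(k ≤ N) → Vec A N → Fin k → A
      restrict q v j = lookup v (inject≤ j q)

      push : A → Vec A N → Vec A N
      push a v = a ∷ tabulate (restrict (n≤1+n M) v)

      restrict-push : ∀ {k} .(q : k ≤ N) .(q′ : suc k ≤ N) a v →
                      restrict q′ (push a v) ≗ extend a (restrict q v)
      restrict-push q q′ a v zero    = refl
      restrict-push q q′ a v (suc j) =
        trans (lookup∘tabulate (restrict (n≤1+n M) v) (inject≤ j _))
              (cong (lookup v) (Fin.inject≤-idempotent j _ (n≤1+n M) q))

      restrict-padRight : ∀ (as : Vec A r) → restrict r≤N (padRight r≤N zero as) ≗ lookup as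
      restrict-padRight as j =
        trans (sym (lookup-truncate r≤N _ j))
              (cong (λ xs → lookup xs j) (truncate-padRight r≤N zero as))

      evalTerms-vars : ∀ v → map (evalTerm 𝒜 (lookup v)) vars ≡ v
      evalTerms-vars v = trans (sym (tabulate-∘ _ var)) (tabulate∘lookup v)

      evalTerms-initVars : ∀ {m} (s : Fin m → A) (f : Fin N → Fin m) →
        map (evalTerm 𝒜 s) (initVars f) ≡ tabulate (λ j → s (f (inject≤ j (n≤1+n M))))
      evalTerms-initVars s f = sym (tabulate-∘ _ _)

      evalTerm-liftTerm : ∀ {k} .(q : k ≤ N) (s : Fin N → A) t →
        evalTerm 𝒜 s (liftTerm q t) ≡ evalTerm 𝒜 (λ j → s (inject≤ j q)) t
      evalTerm-liftTerm q s (var x) = refl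
      evalTerm-liftTerm q s (con c) = refl

      evalTerms-liftTerm : ∀ {k m} .(q : k ≤ N) (s : Fin N → A) (ts : Vec (Term σ k) m) →
        map (evalTerm 𝒜 s) (map (liftTerm q) ts) ≡ map (evalTerm 𝒜 (λ j → s (inject≤ j q))) ts
      evalTerms-liftTerm q s ts = trans (sym (map-∘ _ _ ts)) (map-cong (evalTerm-liftTerm q s) ts)

      liftLit-⇔ : ∀ {k} .(q : k ≤ N) I v l →
                  evalLit I (lookup v) (liftLit q l) ⇔ SatLit 𝒜 l (restrict q v)
      liftLit-⇔ q I v (atom⁺ R ts) =
        ≡⇒⇔ (λ xs → rel 𝒜 R xs ≡ true) (evalTerms-liftTerm q (lookup v) ts)
      liftLit-⇔ q I v (atom⁻ R ts) = ¬-cong-⇔ (liftLit-⇔ q I v (atom⁺ R ts))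
      liftLit-⇔ q I v (equ⁺ t u)   =
        ≡-cong-⇔ (evalTerm-liftTerm q (lookup v) t) (evalTerm-liftTerm q (lookup v) u)
      liftLit-⇔ q I v (equ⁻ t u)   = ¬-cong-⇔ (liftLit-⇔ q I v (equ⁺ t u))

      call-⇔ : ∀ I c v → evalLit I (lookup v) (call c vars) ⇔ I (suc c) v
      call-⇔ I c v = ≡⇒⇔ (I (suc c)) (evalTerms-vars v)

      forall-call-⇔ : ∀ I c v →
        evalLit I (lookup v) (iAll (suc c) 1 (initVars id) refl) ⇔ (∀ a → I (suc c) (push a v))
      forall-call-⇔ I c v = mk⇔ (λ p a → Equivalence.to (pushed a) (p (a ∷ [])))
                                (λ { p (a ∷ []) → Equivalence.from (pushed a) (p a) })
        where
        pushed : ∀ a →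
          I (suc c) (a ∷ map (evalTerm 𝒜 (lookup v)) (initVars id)) ⇔ I (suc c) (push a v)
        pushed a = ≡⇒⇔ (I (suc c)) (cong (a ∷_) (evalTerms-initVars (lookup v) id))

      witness-call-⇔ : ∀ I c a v →
        evalLit I (lookup (a ∷ v)) (call c (var zero ∷ initVars suc)) ⇔ I (suc c) (push a v)
      witness-call-⇔ I c a v =
        ≡⇒⇔ (I (suc c)) (cong (a ∷_) (evalTerms-initVars (lookup (a ∷ v)) suc))

      plain-fires⇒ : ∀ {I j body v} → Fires I (nodeRule j (plain body)) (suc j , v) →
                     All (evalLit I (lookup v)) body
      plain-fires⇒ {I} (s , refl , ps) = All.map (λ {l} → evalLit-cong I s≗ l) ps
        where
        s≗ : s ≗ lookup (map s (allFin N))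
        s≗ x = sym (trans (lookup-map x s (allFin N)) (cong s (lookup-allFin x)))

      plain-fires⇐ : ∀ {I j body} v → All (evalLit I (lookup v)) body →
                     Fires I (nodeRule j (plain body)) (suc j , v)
      plain-fires⇐ v ps = lookup v , cong (suc _ ,_) (map-lookup-allFin v) , ps

      witness-fires⇒ : ∀ {I j body v} → Fires I (nodeRule j (withWitness body)) (suc j , v) →
                       Σ A λ a → All (evalLit I (lookup (a ∷ v))) body
      witness-fires⇒ {I} (s , refl , ps) = s zero , All.map (λ {l} → evalLit-cong I s≗ l) ps
        where
        s≗ : s ≗ lookup (s zero ∷ map s (tabulate suc))
        s≗ zero    = refl
        s≗ (suc x) = sym (trans (lookup-map x s (tabulate suc)) (cong s (lookup∘tabulate suc x)))

      witness-fires⇐ : ∀ {I j body} v → (Σ A λ a → All (evalLit I (lookup (a ∷ v))) body) →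
                       Fires I (nodeRule j (withWitness body)) (suc j , v)
      witness-fires⇐ v (a , ps) = lookup (a ∷ v) , cong (suc _ ,_) hvars≡ , ps
        where
        hvars≡ : map (lookup (a ∷ v)) (tabulate suc) ≡ v
        hvars≡ = trans (sym (tabulate-∘ (lookup (a ∷ v)) suc)) (tabulate∘lookup v)

      Holds : ℕ → Vec A N → Literal′ N → Set
      Holds k v = evalLit (Stage k) (lookup v)

      node-stage : ∀ {k j v cs} → clauses j ≡ cs →
        Stage (suc k) (suc j) v ⇔ Any (λ c → Fires (Stage k) (nodeRule j c) (suc j , v)) (toList cs)
      node-stage {k} {j} {v} refl = mk⇔ Any.map⁻ Any.map⁺ ⇔-∘ stage-suc 𝒜 k (suc j) v

      plain-stage : ∀ {k j v body} → clauses j ≡ plain body ∷ [] →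
        Stage (suc k) (suc j) v ⇔ All (Holds k v) body
      plain-stage eq =
        mk⇔ (plain-fires⇒ ∘ Any.singleton⁻) (here ∘ plain-fires⇐ _) ⇔-∘ node-stage eq

      plain₂-stage : ∀ {k j v body₁ body₂} → clauses j ≡ plain body₁ ∷ plain body₂ ∷ [] →
        Stage (suc k) (suc j) v ⇔ (All (Holds k v) body₁ ⊎ All (Holds k v) body₂)
      plain₂-stage eq = mk⇔ to from ⇔-∘ node-stage eq
        where
        to = λ { (here f) → inj₁ (plain-fires⇒ f) ; (there (here f)) → inj₂ (plain-fires⇒ f) }
        from = λ { (inj₁ ps) → here (plain-fires⇐ _ ps)
                 ; (inj₂ ps) → there (here (plain-fires⇐ _ ps)) }

      witness-stage : ∀ {k j v body} → clauses j ≡ withWitness body ∷ [] →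
        Stage (suc k) (suc j) v ⇔ (Σ A λ a → All (evalLit (Stage k) (lookup (a ∷ v))) body)
      witness-stage eq =
        mk⇔ (witness-fires⇒ ∘ Any.singleton⁻) (here ∘ witness-fires⇐ _) ⇔-∘ node-stage eq

      node-defines : ∀ {k} (ψ : NNF σ k) .(p : k + depth ψ ≤ M) emb → Realises clauses ψ p emb →
        Defines (suc (emb zero)) (SatNNF 𝒜 ψ ∘ restrict (m+n≤o⇒m≤1+o k p)) (height ψ)
      node-defines (lit l) p emb R {suc k} _ v = begin
        Stage (suc k) (suc (emb zero)) v
          ∼⟨ plain-stage (R zero) ⟩
        All (Holds k v) (liftLit _ l ∷ [])
          ∼⟨ all-singleton-⇔ ⟩
        Holds k v (liftLit _ l)
          ∼⟨ liftLit-⇔ _ (Stage k) v l ⟩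
        SatLit 𝒜 l (restrict _ v) ∎
      node-defines {k₀} (and ψ₁ ψ₂) p emb R {suc k} (s≤s h≤k) v = begin
        Stage (suc k) (suc (emb zero)) v
          ∼⟨ plain-stage (R zero) ⟩
        All (Holds k v) (call c₁ vars ∷ call c₂ vars ∷ [])
          ∼⟨ all-pair-⇔ ⟩
        (Holds k v (call c₁ vars) × Holds k v (call c₂ vars))
          ∼⟨ call-⇔ (Stage k) c₁ v ×-⇔ call-⇔ (Stage k) c₂ v ⟩
        (Stage k (suc c₁) v × Stage k (suc c₂) v)
          ∼⟨ D₁ (≤-trans (m≤m⊔n _ _) h≤k) v ×-⇔ D₂ (≤-trans (m≤n⊔m _ _) h≤k) v ⟩
        (SatNNF 𝒜 ψ₁ (restrict _ v) × SatNNF 𝒜 ψ₂ (restrict _ v)) ∎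
        where
        c₁ = emb (leftChild (nodes ψ₂) zero)
        c₂ = emb (rightChild (nodes ψ₁) zero)
        Rs = realises-split {clauses} {ψ₁ = ψ₁} {ψ₂} {emb = emb} (R ∘ suc)
        D₁ = node-defines ψ₁ (m+[n⊔o]≤p⇒m+n≤p k₀ _ _ p) _ (proj₁ Rs)
        D₂ = node-defines ψ₂ (m+[n⊔o]≤p⇒m+o≤p k₀ _ _ p) _ (proj₂ Rs)
      node-defines {k₀} (or ψ₁ ψ₂) p emb R {suc k} (s≤s h≤k) v = begin
        Stage (suc k) (suc (emb zero)) v
          ∼⟨ plain₂-stage (R zero) ⟩
        (All (Holds k v) (call c₁ vars ∷ []) ⊎ All (Holds k v) (call c₂ vars ∷ []))
          ∼⟨ all-singleton-⇔ ⊎-⇔ all-singleton-⇔ ⟩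
        (Holds k v (call c₁ vars) ⊎ Holds k v (call c₂ vars))
          ∼⟨ call-⇔ (Stage k) c₁ v ⊎-⇔ call-⇔ (Stage k) c₂ v ⟩
        (Stage k (suc c₁) v ⊎ Stage k (suc c₂) v)
          ∼⟨ D₁ (≤-trans (m≤m⊔n _ _) h≤k) v ⊎-⇔ D₂ (≤-trans (m≤n⊔m _ _) h≤k) v ⟩
        (SatNNF 𝒜 ψ₁ (restrict _ v) ⊎ SatNNF 𝒜 ψ₂ (restrict _ v)) ∎
        where
        c₁ = emb (leftChild (nodes ψ₂) zero)
        c₂ = emb (rightChild (nodes ψ₁) zero)
        Rs = realises-split {clauses} {ψ₁ = ψ₁} {ψ₂} {emb = emb} (R ∘ suc)
        D₁ = node-defines ψ₁ (m+[n⊔o]≤p⇒m+n≤p k₀ _ _ p) _ (proj₁ Rs)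
        D₂ = node-defines ψ₂ (m+[n⊔o]≤p⇒m+o≤p k₀ _ _ p) _ (proj₂ Rs)
      node-defines {k₀} (all θ) p emb R {suc k} (s≤s h≤k) v = begin
        Stage (suc k) (suc (emb zero)) v
          ∼⟨ plain-stage (R zero) ⟩
        All (Holds k v) (iAll (suc c) 1 (initVars id) refl ∷ [])
          ∼⟨ all-singleton-⇔ ⟩
        Holds k v (iAll (suc c) 1 (initVars id) refl)
          ∼⟨ forall-call-⇔ (Stage k) c v ⟩
        (∀ a → Stage k (suc c) (push a v))
          ∼⟨ ∀-cong-⇔ (λ a → D h≤k (push a v)) ⟩
        (∀ a → SatNNF 𝒜 θ (restrict _ (push a v)))
          ∼⟨ ∀-cong-⇔ (λ a → satNNF-≗-⇔ 𝒜 (restrict-push _ _ a v) θ) ⟩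
        (∀ a → SatNNF 𝒜 θ (extend a (restrict _ v))) ∎
        where
        c = emb (suc zero)
        D = node-defines θ (m+[1+n]≤o⇒1+m+n≤o k₀ _ p) (emb ∘ suc) (R ∘ suc)
      node-defines {k₀} (ex θ) p emb R {suc k} (s≤s h≤k) v = begin
        Stage (suc k) (suc (emb zero)) v
          ∼⟨ witness-stage (R zero) ⟩
        (Σ A λ a → All (evalLit (Stage k) (lookup (a ∷ v))) (call c (var zero ∷ initVars suc) ∷ []))
          ∼⟨ ∃-cong-⇔ (λ a → witness-call-⇔ (Stage k) c a v ⇔-∘ all-singleton-⇔) ⟩
        (Σ A λ a → Stage k (suc c) (push a v))
          ∼⟨ ∃-cong-⇔ (λ a → D h≤k (push a v)) ⟩
        (Σ A λ a → SatNNF 𝒜 θ (restrict _ (push a v)))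
          ∼⟨ ∃-cong-⇔ (λ a → satNNF-≗-⇔ 𝒜 (restrict-push _ _ a v) θ) ⟩
        (Σ A λ a → SatNNF 𝒜 θ (extend a (restrict _ v))) ∎
        where
        c = emb (suc zero)
        D = node-defines θ (m+[1+n]≤o⇒1+m+n≤o k₀ _ p) (emb ∘ suc) (R ∘ suc)

      top-fires⇒ : ∀ {I as} → Fires I topRule (zero , as) →
                   Σ (Vec A N) λ w → restrict r≤N w ≗ lookup as × I (suc root) w
      top-fires⇒ {I} (s , refl , (x ∷ [])) =
        tabulate s , w≗ , subst (I (suc root)) (sym (tabulate-∘ (evalTerm 𝒜 s) var)) x
        where
        hvars = tabulate (λ j → inject≤ j r≤N)
        w≗ : restrict r≤N (tabulate s) ≗ lookup (map s hvars)
        w≗ j = trans (lookup∘tabulate s (inject≤ j r≤N))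
                     (sym (trans (lookup-map j s hvars) (cong s (lookup∘tabulate _ j))))

      top-fires⇐ : ∀ {I} as w → restrict r≤N w ≗ lookup as → I (suc root) w →
                   Fires I topRule (zero , as)
      top-fires⇐ {I} as w w≗ x =
        lookup w , cong (zero ,_) hvars≡ , (subst (I (suc root)) (sym (evalTerms-vars w)) x ∷ [])
        where
        hvars≡ : map (lookup w) (tabulate (λ j → inject≤ j r≤N)) ≡ as
        hvars≡ = trans (sym (tabulate-∘ _ _)) (trans (tabulate-cong w≗) (tabulate∘lookup as))

      top-defines : ∀ (ψ : NNF σ r) {h} → Defines (suc root) (SatNNF 𝒜 ψ ∘ restrict r≤N) h →
                    Defines zero (SatNNF 𝒜 ψ ∘ lookup) (suc h)
      top-defines ψ D {suc k} (s≤s h≤k) as = mk⇔ to from ⇔-∘ stage-suc 𝒜 k zero as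
        where
        to : Any (λ ρ → Fires (Stage k) ρ (zero , as)) (topRule ∷ []) → SatNNF 𝒜 ψ (lookup as)
        to (here f) with top-fires⇒ f
        ... | w , w≗ , x = satNNF-cong 𝒜 w≗ ψ (Equivalence.to (D h≤k w) x)

        -- The top rule leaves positions r, …, N - 1 of the root tuple free; any padding will do.
        w = padRight r≤N zero as

        from : SatNNF 𝒜 ψ (lookup as) → Any (λ ρ → Fires (Stage k) ρ (zero , as)) (topRule ∷ [])
        from sat = here (top-fires⇐ as w (restrict-padRight as)
          (Equivalence.from (D h≤k w) (satNNF-cong 𝒜 (sym ∘ restrict-padRight as) ψ sat)))

proposition2 : (σ : Sig) (r : ℕ) (φ : Formula σ r) →
    Σ (Program σ) λ Π → HeadsExact Π × (Σ (Fin (nI Π)) λ P →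
      Σ (iar Π P ≡ r) λ e → Bounded Π P ×
        ((n : ℕ) (𝒜 : Structure σ n) (as : Vec (Fin (suc n)) (iar Π P)) →
          ((𝒜 ⊨ φ [ subst (Vec (Fin (suc n))) e as ]) ⇔ (𝒜 ⊨⟨ Π , P ⟩[ as ]))))
proposition2 σ r φ =
  program , headsExact , zero , refl ,
  (suc (height φ⁺) , λ n 𝒜 → StageProperties.defines⇒stage⇔fix program 𝒜 (defines 𝒜)) ,
  λ n 𝒜 as → ⇔-sym (StageProperties.defines⇒fix⇔ program 𝒜 (defines 𝒜) as)
               ⇔-∘ ⇔-sym (nnf⁺-correct 𝒜 φ (lookup as))
  where
  φ⁺ = nnf⁺ φ
  open Compilation σ r (depth φ⁺) (nodes φ⁺)
  open Realisation (clausesAt φ⁺ ≤-refl id) zero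

  defines : ∀ {n} (𝒜 : Structure σ n) →
    StageProperties.Defines program 𝒜 zero (SatNNF 𝒜 φ⁺ ∘ lookup) (suc (height φ⁺))
  defines 𝒜 = top-defines 𝒜 φ⁺ (node-defines 𝒜 φ⁺ ≤-refl id (λ _ → refl))
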